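{- Let $m$ and $n$ be positive integers with $m \geq n$, let $d=\gcd(m,n)$, and let $r \geq 0$. Consider the Diophantine problem $$n x - m y = r, \qquad 0 \leq x \leq m,\ 0 \leq y \leq n,\qquad (x,y)\in\mathbb{Z}^2. \qquad (\ast)$$ Then $(\ast)$ has an integer solution only if $d$ divides $r$ and $0 \leq r \leq nm$. Moreover, if $d$ divides $r$ and $0\le r\le nm$, the number of integer solutions of $(\ast)$ equals $$\alpha_r := d + 1 - \left\lceil \frac{p+a}{m/d} \right\rceil,$$ where $$p = \left\lfloor \frac{r}{n} \right\rfloor \quad\text{and}\quad a = \frac{r - n p}{d}\,(n/d)^{ -1} \bmod m/d,$$ with $a$ taken in $\{0,1,\ldots,m/d-1\}$. Here $(n/d)^{ -1}$ denotes the multiplicative inverse of $n/d$ in the ring $\mathbb{Z}_{m/d}=\{0,1,\ldots,m/d-1\}$.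
   Context: $\lceil x\rceil$ denotes the smallest integer $\geq x$ and $\lfloor x\rfloor$ the largest integer $\leq x$. Since $\gcd(m/d,n/d)=1$, $n/d$ is invertible modulo $m/d$; and since $d$ divides both $r$ and $n$, the quantity $(r-np)/d$ is an integer. -}

module Defs where

open import Data.Nat using (ℕ; zero; suc; _+_; _*_; _∸_; _≡ᵇ_)
open import Data.Nat.DivMod using (_/_; _%_)
open import Data.Nat.GCD using (gcd)
open import Data.Integer using (ℤ; +_; _-_)
open import Data.List using (List; length; filterᵇ; cartesianProduct; upTo)
open import Data.Product using (_×_; _,_)

-- They agree with the stdlib ⌊a/b⌋, a mod b, ⌈a/b⌉ whenever b > 0
-- (the value at b = 0 is an irrelevant default; in the theorem all divisors are positive).
divℕ : ℕ → ℕ → ℕ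
divℕ a zero    = 0
divℕ a (suc k) = a / suc k

modℕ : ℕ → ℕ → ℕ
modℕ a zero    = a
modℕ a (suc k) = a % suc k

-- ⌈ a / b ⌉ for b > 0, namely ⌊ (a + b - 1) / b ⌋
ceilDiv : ℕ → ℕ → ℕ
ceilDiv a zero    = 0
ceilDiv a (suc k) = (a + k) / suc k

solutions : ℕ → ℕ → ℕ → List (ℕ × ℕ)
solutions m n r =
  filterᵇ (λ { (x , y) → (n * x) ≡ᵇ (m * y + r) })
          (cartesianProduct (upTo (suc m)) (upTo (suc n)))

numSolutions : ℕ → ℕ → ℕ → ℕ
numSolutions m n r = length (solutions m n r)

pOf : ℕ → ℕ → ℕ
pOf n r = divℕ r n

aOf : ℕ → ℕ → ℕ → ℕ → ℕ
aOf m n r inv =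
  let d = gcd m n in
  modℕ (divℕ (r ∸ n * pOf n r) d * inv) (divℕ m d)

alpha : ℕ → ℕ → ℕ → ℕ → ℤ
alpha m n r inv =
  let d = gcd m n in
  + (d + 1) - + ceilDiv (pOf n r + aOf m n r inv) (divℕ m d)

{-# OPTIONS --safe #-}
module Submission where

-- Write m = M d, n = N d and r = n p + t d, where p = ⌊r/n⌋ and t d = r mod n, so t < M.
-- Dividing by d, n x = m y + r becomes N x = M y + (N p + t); this forces x ≥ p and
-- N (x − p) ≡ t (mod M), i.e. x − p ≡ a (mod M).  Conversely every x in the arithmetic
-- progression c, c + M, c + 2M, … with c = p + a yields exactly one y, and y ≤ n is automatic
-- once x ≤ m.  So the solutions correspond to the x ≤ m = d M in that progression; there are
-- ⌈(m + 1 − c)/M⌉ = ⌊((d + 1) M − c)/M⌋ of them, and this equals d + 1 − ⌈c/M⌉ because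
-- c ≤ m + M − 1.

open import Defs
open import Data.Nat using (ℕ; _≥_; _<_; _≤_; NonZero)
open import Data.Nat.Divisibility using (_∣_)
open import Data.Nat.GCD using (gcd)
open import Data.Integer using (ℤ; +_; _-_)
open import Data.Product using (Σ; _×_; _,_)
open import Relation.Binary.PropositionalEquality using (_≡_)

open import Level using (Level)
open import Function using (_∘_)
open import Data.Bool using (T; true; false)
open import Data.Empty using (⊥-elim)
open import Data.Nat
  using (zero; suc; _+_; _*_; _∸_; _/_; _%_; _≡ᵇ_; s≤s; s≤s⁻¹; ≢-nonZero; ≢-nonZero⁻¹)
open import Data.Nat.Properties
open import Data.Nat.DivMod
open import Data.Nat.Divisibility
  using (divides; _∣?_; ∣-refl; ∣-trans; m∣m*n; n∣m*n; ∣m+n∣m⇒∣n; _∣0; %-presˡ-∣)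
open import Data.Nat.GCD using (gcd[m,n]∣m; gcd[m,n]∣n; gcd[m,n]≢0)
open import Data.Nat.Tactic.RingSolver using (solve)
open import Data.Integer as ℤ using (+≤+)
import Data.Integer.Properties as ℤₚ
open import Algebra.Properties.AbelianGroup ℤₚ.+-0-abelianGroup
  using (//-rightDividesˡ; //-rightDividesʳ)
open import Data.List using ([]; _∷_; [_]; _++_; length; map; filter; cartesianProduct; upTo)
open import Data.List.Properties
  using (filter-++; filter-accept; filter-reject; filter-none; length-++; upTo-∷ʳ)
open import Data.List.Membership.Propositional using (_∈_)
open import Data.List.Membership.Propositional.Properties using (∈-upTo⁻)
import Data.List.Relation.Unary.All as All
open import Data.List.Relation.Unary.All.Properties using (all-upTo)
open import Data.List.Relation.Unary.Any using (here; there)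
open import Data.Product using (∃-syntax; proj₁; proj₂)
open import Data.Sum using (inj₁)
open import Relation.Nullary using (¬_; Dec; yes; no; does)
open import Relation.Nullary.Decidable using (_×-dec_; T?)
open import Relation.Unary using (Pred; Decidable)
open import Relation.Binary.PropositionalEquality
  using (refl; sym; trans; cong; cong₂; subst; module ≡-Reasoning)
open ≡-Reasoning

private variable
  ℓ₁ ℓ₂ ℓ₃ ℓ₄ : Level
  A : Set ℓ₁
  B : Set ℓ₂

-- Counting in filtered lists

module _ {P : Pred B ℓ₃} (P? : Decidable P) where

  length-filter-map : ∀ (f : A → B) xs → length (filter P? (map f xs)) ≡ length (filter (P? ∘ f) xs)
  length-filter-map f [] = refl
  length-filter-map f (x ∷ xs) with does (P? (f x))
  ... | true  = cong suc (length-filter-map f xs)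
  ... | false = length-filter-map f xs

module _ {P : Pred (A × B) ℓ₃} (P? : Decidable P) {Q : Pred A ℓ₄} (Q? : Decidable Q) where

  length-filter-cartesianProduct : ∀ xs ys →
    (∀ {x} → x ∈ xs → Q x → length (filter (P? ∘ (x ,_)) ys) ≡ 1) →
    (∀ {x} → ¬ Q x → length (filter (P? ∘ (x ,_)) ys) ≡ 0) →
    length (filter P? (cartesianProduct xs ys)) ≡ length (filter Q? xs)
  length-filter-cartesianProduct [] ys _ _ = refl
  length-filter-cartesianProduct (x ∷ xs) ys one none = begin
    length (filter P? (row ++ cartesianProduct xs ys))
      ≡⟨ cong length (filter-++ P? row (cartesianProduct xs ys)) ⟩
    length (filter P? row ++ filter P? (cartesianProduct xs ys))
      ≡⟨ length-++ (filter P? row) ⟩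
    length (filter P? row) + length (filter P? (cartesianProduct xs ys))
      ≡⟨ cong₂ _+_ (length-filter-map P? (x ,_) ys)
                   (length-filter-cartesianProduct xs ys (one ∘ there) none) ⟩
    length (filter (P? ∘ (x ,_)) ys) + length (filter Q? xs)
      ≡⟨ count-row (Q? x) ⟩
    length (filter Q? (x ∷ xs)) ∎
    where
    row = map (x ,_) ys
    count-row : Dec (Q x) →
      length (filter (P? ∘ (x ,_)) ys) + length (filter Q? xs) ≡ length (filter Q? (x ∷ xs))
    count-row (yes Qx) = trans (cong (_+ _) (one (here refl) Qx)) (sym (cong length (filter-accept Q? Qx)))
    count-row (no ¬Qx) = trans (cong (_+ _) (none ¬Qx)) (sym (cong length (filter-reject Q? ¬Qx)))

module _ {P : Pred ℕ ℓ₃} (P? : Decidable P) where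

  length-filter-upTo-suc : ∀ k →
    length (filter P? (upTo (suc k))) ≡ length (filter P? (upTo k)) + length (filter P? [ k ])
  length-filter-upTo-suc k = begin
    length (filter P? (upTo (suc k)))             ≡⟨ cong (length ∘ filter P?) (upTo-∷ʳ k) ⟨
    length (filter P? (upTo k ++ [ k ]))          ≡⟨ cong length (filter-++ P? (upTo k) [ k ]) ⟩
    length (filter P? (upTo k) ++ filter P? [ k ]) ≡⟨ length-++ (filter P? (upTo k)) ⟩
    length (filter P? (upTo k)) + length (filter P? [ k ]) ∎

  length-filter-upTo-accept : ∀ {k} → P k →
    length (filter P? (upTo (suc k))) ≡ suc (length (filter P? (upTo k)))
  length-filter-upTo-accept {k} Pk = begin
    length (filter P? (upTo (suc k)))                      ≡⟨ length-filter-upTo-suc k ⟩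
    length (filter P? (upTo k)) + length (filter P? [ k ])
      ≡⟨ cong (λ ys → length (filter P? (upTo k)) + length ys) (filter-accept P? Pk) ⟩
    length (filter P? (upTo k)) + 1                        ≡⟨ +-comm _ 1 ⟩
    suc (length (filter P? (upTo k)))                      ∎

  length-filter-upTo-reject : ∀ {k} → ¬ P k →
    length (filter P? (upTo (suc k))) ≡ length (filter P? (upTo k))
  length-filter-upTo-reject {k} ¬Pk = begin
    length (filter P? (upTo (suc k)))                      ≡⟨ length-filter-upTo-suc k ⟩
    length (filter P? (upTo k)) + length (filter P? [ k ])
      ≡⟨ cong (λ ys → length (filter P? (upTo k)) + length ys) (filter-reject P? ¬Pk) ⟩
    length (filter P? (upTo k)) + 0                        ≡⟨ +-identityʳ _ ⟩
    length (filter P? (upTo k))                            ∎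

  length-filter-upTo-unique : ∀ {y₀ k} → (∀ {y} → P y → y ≡ y₀) → P y₀ → y₀ < k →
    length (filter P? (upTo k)) ≡ 1
  length-filter-upTo-unique {y₀} {suc k} unique Py₀ y₀<1+k with y₀ ≟ k
  ... | yes refl = begin
    length (filter P? (upTo (suc y₀)))   ≡⟨ length-filter-upTo-accept Py₀ ⟩
    suc (length (filter P? (upTo y₀)))
      ≡⟨ cong (suc ∘ length) (filter-none P? (All.map below-y₀ (all-upTo y₀))) ⟩
    1 ∎
    where
    below-y₀ : ∀ {y} → y < y₀ → ¬ P y
    below-y₀ y<y₀ Py = <-irrefl (unique Py) y<y₀
  ... | no y₀≢k = trans (length-filter-upTo-reject (y₀≢k ∘ sym ∘ unique))
                        (length-filter-upTo-unique unique Py₀ (≤∧≢⇒< (s≤s⁻¹ y₀<1+k) y₀≢k))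

-- Floor and ceiling division

m<n⇒[m+kn]/n≡k : ∀ {m n} k .{{_ : NonZero n}} → m < n → (m + k * n) / n ≡ k
m<n⇒[m+kn]/n≡k {m} {n} k m<n = begin
  (m + k * n) / n    ≡⟨ +-distrib-/-∣ʳ m (n∣m*n k) ⟩
  m / n + k * n / n  ≡⟨ cong₂ _+_ (m<n⇒m/n≡0 m<n) (m*n/n≡m k n) ⟩
  k                  ∎

[1+m]/n≡m/n : ∀ {m n} .{{_ : NonZero n}} → ¬ n ∣ suc m → suc m / n ≡ m / n
[1+m]/n≡m/n {m} {n} n∤1+m = begin
  suc m / n                        ≡⟨ /-congˡ (cong suc (m≡m%n+[m/n]*n m n)) ⟩
  (suc (m % n) + m / n * n) / n    ≡⟨ m<n⇒[m+kn]/n≡k (m / n) 1+m%n<n ⟩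
  m / n                            ∎
  where
  1+m%n<n : suc (m % n) < n
  1+m%n<n = ≤∧≢⇒< (m%n<n m n) λ 1+m%n≡n →
    n∤1+m (divides (suc (m / n))
      (trans (cong suc (m≡m%n+[m/n]*n m n)) (cong (_+ m / n * n) 1+m%n≡n)))

ceilDiv-suc : ∀ j k → ceilDiv (suc j) (suc k) ≡ suc (j / suc k)
ceilDiv-suc j k = begin
  suc (j + k) / suc k            ≡⟨ /-congˡ (+-suc j k) ⟨
  (j + suc k) / suc k            ≡⟨ +-distrib-/-∣ʳ j ∣-refl ⟩
  j / suc k + suc k / suc k      ≡⟨ cong (_+_ (j / suc k)) (n/n≡1 (suc k)) ⟩
  j / suc k + 1                  ≡⟨ +-comm _ 1 ⟩
  suc (j / suc k)                ∎

ceilDiv-∣ : ∀ {j k} → suc k ∣ j → ceilDiv j (suc k) ≡ j / suc k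
ceilDiv-∣ {j} {k} k+1∣j = begin
  (j + k) / suc k          ≡⟨ +-distrib-/-∣ˡ k k+1∣j ⟩
  j / suc k + k / suc k    ≡⟨ cong (_+_ (j / suc k)) (m<n⇒m/n≡0 (n<1+n k)) ⟩
  j / suc k + 0            ≡⟨ +-identityʳ _ ⟩
  j / suc k                ∎

ceilDiv-∤ : ∀ {j k} → ¬ suc k ∣ j → ceilDiv j (suc k) ≡ suc (j / suc k)
ceilDiv-∤ {zero}  {k} k+1∤0   = ⊥-elim (k+1∤0 (suc k ∣0))
ceilDiv-∤ {suc j} {k} k+1∤1+j = trans (ceilDiv-suc j k) (cong suc (sym ([1+m]/n≡m/n k+1∤1+j)))

ceilDiv-∸ : ∀ L c k → ceilDiv (L ∸ c) (suc k) ≡ (L + k ∸ c) / suc k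
ceilDiv-∸ L c k with c ≤? L
... | yes c≤L = /-congˡ (sym (+-∸-comm k c≤L))
... | no  c≰L = begin
  (L ∸ c + k) / suc k   ≡⟨ /-congˡ (cong (_+ k) (m≤n⇒m∸n≡0 (<⇒≤ L<c))) ⟩
  k / suc k             ≡⟨ m<n⇒m/n≡0 (n<1+n k) ⟩
  0                     ≡⟨ m<n⇒m/n≡0 (s≤s L+k∸c≤k) ⟨
  (L + k ∸ c) / suc k   ∎
  where
  L<c = ≰⇒> c≰L
  L+k∸c≤k : L + k ∸ c ≤ k
  L+k∸c≤k = ≤-trans (∸-monoˡ-≤ c (+-monoˡ-≤ k (<⇒≤ L<c))) (≤-reflexive (m+n∸m≡n c k))

ceilDiv-upper : ∀ j k → j ≤ ceilDiv j (suc k) * suc k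
ceilDiv-upper j k = +-cancelʳ-≤ k j _ (≤-trans (≤-reflexive (m≡m%n+[m/n]*n (j + k) (suc k)))
  (≤-trans (+-monoˡ-≤ _ (s≤s⁻¹ (m%n<n (j + k) (suc k)))) (≤-reflexive (+-comm k _))))

ceilDiv-lower : ∀ j k → ceilDiv j (suc k) * suc k < j + suc k
ceilDiv-lower j k = ≤-<-trans (m/n*n≤m (j + k) (suc k)) (+-monoʳ-< j ≤-refl)

[m*n∸o]/n+ceilDiv[o,n]≡m : ∀ K k {c} → c ≤ K * suc k →
  (K * suc k ∸ c) / suc k + ceilDiv c (suc k) ≡ K
[m*n∸o]/n+ceilDiv[o,n]≡m K k {c} c≤KM = begin
  (K * M ∸ c) / M + s            ≡⟨ cong (λ z → z / M + s) KM∸c≡ ⟩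
  (s * M ∸ c + e * M) / M + s    ≡⟨ cong (_+ s) (m<n⇒[m+kn]/n≡k e sM∸c<M) ⟩
  e + s                          ≡⟨ m∸n+n≡m s≤K ⟩
  K                              ∎
  where
  M = suc k
  s = ceilDiv c M
  e = K ∸ s
  c≤sM = ceilDiv-upper c k
  sM∸c<M : s * M ∸ c < M
  sM∸c<M = m<n+o⇒m∸n<o (s * M) c (ceilDiv-lower c k)
  s≤K : s ≤ K
  s≤K = s≤s⁻¹ (*-cancelʳ-< M s (suc K) (<-≤-trans (ceilDiv-lower c k)
          (≤-trans (+-monoˡ-≤ M c≤KM) (≤-reflexive (+-comm (K * M) M)))))
  KM∸c≡ : K * M ∸ c ≡ s * M ∸ c + e * M
  KM∸c≡ = begin
    K * M ∸ c              ≡⟨ cong (λ z → z * M ∸ c) (m∸n+n≡m s≤K) ⟨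
    (e + s) * M ∸ c        ≡⟨ cong (_∸ c) (*-distribʳ-+ M e s) ⟩
    e * M + s * M ∸ c      ≡⟨ +-∸-assoc (e * M) c≤sM ⟩
    e * M + (s * M ∸ c)    ≡⟨ +-comm (e * M) _ ⟩
    s * M ∸ c + e * M      ∎

-- Arithmetic progressions

InProgression : ℕ → ℕ → ℕ → Set
InProgression c M x = c ≤ x × M ∣ x ∸ c

inProgression? : ∀ c M → Decidable (InProgression c M)
inProgression? c M x = c ≤? x ×-dec M ∣? x ∸ c

inProgression⁺ : ∀ {c M} q → InProgression c M (c + q * M)
inProgression⁺ {c} q = m≤m+n c _ , divides q (m+n∸m≡n c _)

inProgression⁻ : ∀ {c M x} → InProgression c M x → ∃[ q ] x ≡ c + q * M
inProgression⁻ {c} (c≤x , divides q x∸c≡qM) =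
  q , trans (sym (m+[n∸m]≡n c≤x)) (cong (_+_ c) x∸c≡qM)

length-filter-inProgression : ∀ c k L →
  length (filter (inProgression? c (suc k)) (upTo L)) ≡ ceilDiv (L ∸ c) (suc k)
length-filter-inProgression c k zero =
  sym (trans (cong (λ j → ceilDiv j (suc k)) (0∸n≡0 c)) (m<n⇒m/n≡0 (n<1+n k)))
length-filter-inProgression c k (suc L) with c ≤? L
... | no c≰L = begin
  length (filter P? (upTo (suc L)))   ≡⟨ length-filter-upTo-reject P? (c≰L ∘ proj₁) ⟩
  length (filter P? (upTo L))         ≡⟨ length-filter-inProgression c k L ⟩
  ceilDiv (L ∸ c) M                   ≡⟨ cong (λ j → ceilDiv j M) (m≤n⇒m∸n≡0 (<⇒≤ L<c)) ⟩
  ceilDiv 0 M                         ≡⟨ cong (λ j → ceilDiv j M) (m≤n⇒m∸n≡0 L<c) ⟨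
  ceilDiv (suc L ∸ c) M               ∎
  where
  M = suc k
  P? = inProgression? c M
  L<c = ≰⇒> c≰L
... | yes c≤L = begin
  length (filter P? (upTo (suc L)))   ≡⟨ step (M ∣? L ∸ c) ⟩
  ceilDiv (suc (L ∸ c)) M             ≡⟨ cong (λ j → ceilDiv j M) (+-∸-assoc 1 c≤L) ⟨
  ceilDiv (suc L ∸ c) M               ∎
  where
  M = suc k
  P? = inProgression? c M
  IH = length-filter-inProgression c k L
  step : Dec (M ∣ L ∸ c) → length (filter P? (upTo (suc L))) ≡ ceilDiv (suc (L ∸ c)) M
  step (yes M∣L∸c) = begin
    length (filter P? (upTo (suc L)))   ≡⟨ length-filter-upTo-accept P? (c≤L , M∣L∸c) ⟩
    suc (length (filter P? (upTo L)))   ≡⟨ cong suc (trans IH (ceilDiv-∣ M∣L∸c)) ⟩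
    suc ((L ∸ c) / M)                   ≡⟨ ceilDiv-suc (L ∸ c) k ⟨
    ceilDiv (suc (L ∸ c)) M             ∎
  step (no M∤L∸c) = begin
    length (filter P? (upTo (suc L)))   ≡⟨ length-filter-upTo-reject P? (M∤L∸c ∘ proj₂) ⟩
    length (filter P? (upTo L))         ≡⟨ trans IH (ceilDiv-∤ M∤L∸c) ⟩
    suc ((L ∸ c) / M)                   ≡⟨ ceilDiv-suc (L ∸ c) k ⟨
    ceilDiv (suc (L ∸ c)) M             ∎

-- The reduced equation N x = M y + (N p + t)

inProgression⇒reduced : ∀ M N p t {a x} .{{_ : NonZero M}} → N * a % M ≡ t →
  InProgression (p + a) M x → ∃[ y ] N * x ≡ M * y + (N * p + t)
inProgression⇒reduced M N p t {a} N*a%M≡t prog with inProgression⁻ prog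
... | q , refl = N * a / M + N * q , rearrange N*a≡t+[N*a/M]*M
  where
  N*a≡t+[N*a/M]*M : N * a ≡ t + N * a / M * M
  N*a≡t+[N*a/M]*M = trans (m≡m%n+[m/n]*n (N * a) M) (cong (_+ N * a / M * M) N*a%M≡t)
  rearrange : ∀ {z} → N * a ≡ t + z * M → N * (p + a + q * M) ≡ M * (z + N * q) + (N * p + t)
  rearrange {z} N*a≡t+zM = begin
    N * (p + a + q * M)              ≡⟨ solve (N ∷ p ∷ a ∷ q ∷ M ∷ []) ⟩
    N * p + N * a + N * q * M        ≡⟨ cong (λ w → N * p + w + N * q * M) N*a≡t+zM ⟩
    N * p + (t + z * M) + N * q * M  ≡⟨ solve (N ∷ p ∷ t ∷ z ∷ q ∷ M ∷ []) ⟩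
    M * (z + N * q) + (N * p + t)    ∎

module Inverse {M N inv : ℕ} .{{_ : NonZero M}} (N*inv≡1 : N * inv % M ≡ 1 % M) where

  [N*u*inv]%M≡u%M : ∀ u → N * u * inv % M ≡ u % M
  [N*u*inv]%M≡u%M u = begin
    N * u * inv % M                    ≡⟨ cong (_% M) (solve (N ∷ u ∷ inv ∷ [])) ⟩
    u * (N * inv) % M                  ≡⟨ %-distribˡ-* u (N * inv) M ⟩
    (u % M) * (N * inv % M) % M        ≡⟨ cong (λ v → (u % M) * v % M) N*inv≡1 ⟩
    (u % M) * (1 % M) % M              ≡⟨ %-distribˡ-* u 1 M ⟨
    u * 1 % M                          ≡⟨ cong (_% M) (*-identityʳ u) ⟩
    u % M                              ∎

  N*u≡My+t⇒u%M≡t*inv%M : ∀ {u y t} → N * u ≡ M * y + t → u % M ≡ t * inv % M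
  N*u≡My+t⇒u%M≡t*inv%M {u} {y} {t} N*u≡My+t = begin
    u % M                        ≡⟨ [N*u*inv]%M≡u%M u ⟨
    N * u * inv % M              ≡⟨ cong (_% M) (cong (_* inv) N*u≡My+t) ⟩
    (M * y + t) * inv % M        ≡⟨ cong (_% M) (solve (M ∷ y ∷ t ∷ inv ∷ [])) ⟩
    (t * inv + y * inv * M) % M  ≡⟨ [m+kn]%n≡m%n (t * inv) (y * inv) M ⟩
    t * inv % M                  ∎

  N*[t*inv%M]%M≡t : ∀ {t} → t < M → N * (t * inv % M) % M ≡ t
  N*[t*inv%M]%M≡t {t} t<M = begin
    N * (t * inv % M) % M              ≡⟨ %-distribˡ-* N (t * inv % M) M ⟩
    (N % M) * (t * inv % M % M) % M    ≡⟨ cong (λ v → (N % M) * v % M) (m%n%n≡m%n (t * inv) M) ⟩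
    (N % M) * (t * inv % M) % M        ≡⟨ %-distribˡ-* N (t * inv) M ⟨
    N * (t * inv) % M                  ≡⟨ cong (_% M) (sym (*-assoc N t inv)) ⟩
    N * t * inv % M                    ≡⟨ [N*u*inv]%M≡u%M t ⟩
    t % M                              ≡⟨ m<n⇒m%n≡m t<M ⟩
    t                                  ∎

  reduced⇒inProgression : ∀ p t {x y} .{{_ : NonZero N}} → N * x ≡ M * y + (N * p + t) →
    InProgression (p + t * inv % M) M x
  reduced⇒inProgression p t {x} {y} N*x≡My+Np+t =
    subst (InProgression (p + t * inv % M) M) (sym x≡c+qM) (inProgression⁺ (u / M))
    where
    N*x≡Np+[My+t] : N * x ≡ N * p + (M * y + t)
    N*x≡Np+[My+t] = trans N*x≡My+Np+t (solve (M ∷ y ∷ N ∷ p ∷ t ∷ []))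
    p≤x : p ≤ x
    p≤x = *-cancelˡ-≤ N (subst (N * p ≤_) (sym N*x≡Np+[My+t]) (m≤m+n (N * p) _))
    u = x ∸ p
    N*u≡My+t : N * u ≡ M * y + t
    N*u≡My+t = begin
      N * (x ∸ p)                    ≡⟨ *-distribˡ-∸ N x p ⟩
      N * x ∸ N * p                  ≡⟨ cong (_∸ N * p) N*x≡Np+[My+t] ⟩
      N * p + (M * y + t) ∸ N * p    ≡⟨ m+n∸m≡n (N * p) _ ⟩
      M * y + t                      ∎
    x≡c+qM : x ≡ p + t * inv % M + u / M * M
    x≡c+qM = begin
      x                                  ≡⟨ m+[n∸m]≡n p≤x ⟨
      p + u                              ≡⟨ cong (_+_ p) (m≡m%n+[m/n]*n u M) ⟩
      p + (u % M + u / M * M)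
        ≡⟨ cong (λ v → p + (v + u / M * M)) (N*u≡My+t⇒u%M≡t*inv%M N*u≡My+t) ⟩
      p + (t * inv % M + u / M * M)      ≡⟨ +-assoc p _ _ ⟨
      p + t * inv % M + u / M * M        ∎

-- Counting the solutions

module _ {m n r x y : ℕ} (n*x≡m*y+r : n * x ≡ m * y + r) where

  solution⇒∣ : ∀ {d} → d ∣ m → d ∣ n → d ∣ r
  solution⇒∣ {d} d∣m d∣n =
    ∣m+n∣m⇒∣n (subst (d ∣_) n*x≡m*y+r (∣-trans d∣n (m∣m*n x))) (∣-trans d∣m (m∣m*n y))

  solution⇒≤ : x ≤ m → r ≤ n * m
  solution⇒≤ x≤m = ≤-trans (m≤n+m r (m * y)) (subst (_≤ n * m) n*x≡m*y+r (*-monoʳ-≤ n x≤m))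

  solution⇒y≤n : .{{_ : NonZero m}} → x ≤ m → y ≤ n
  solution⇒y≤n x≤m = *-cancelˡ-≤ m (≤-trans (m≤m+n (m * y) r)
    (subst (_≤ m * n) n*x≡m*y+r (≤-trans (*-monoʳ-≤ n x≤m) (≤-reflexive (*-comm n m)))))

  solution-unique : .{{_ : NonZero m}} → ∀ {y′} → n * x ≡ m * y′ + r → y ≡ y′
  solution-unique n*x≡m*y′+r =
    *-cancelˡ-≡ y _ m (+-cancelʳ-≡ r _ _ (trans (sym n*x≡m*y+r) n*x≡m*y′+r))

module _ (d M N p t : ℕ) {x y : ℕ} where

  ÷-common-factor : .{{_ : NonZero d}} →
    N * d * x ≡ M * d * y + (N * d * p + t * d) → N * x ≡ M * y + (N * p + t)
  ÷-common-factor eq = *-cancelʳ-≡ _ _ d (begin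
    N * x * d                             ≡⟨ solve (N ∷ x ∷ d ∷ []) ⟩
    N * d * x                             ≡⟨ eq ⟩
    M * d * y + (N * d * p + t * d)       ≡⟨ solve (M ∷ d ∷ y ∷ N ∷ p ∷ t ∷ []) ⟩
    (M * y + (N * p + t)) * d             ∎)

  ×-common-factor : N * x ≡ M * y + (N * p + t) → N * d * x ≡ M * d * y + (N * d * p + t * d)
  ×-common-factor eq = begin
    N * d * x                             ≡⟨ solve (N ∷ x ∷ d ∷ []) ⟩
    N * x * d                             ≡⟨ cong (_* d) eq ⟩
    (M * y + (N * p + t)) * d             ≡⟨ solve (M ∷ d ∷ y ∷ N ∷ p ∷ t ∷ []) ⟩
    M * d * y + (N * d * p + t * d)       ∎

module Count (k d N p t inv : ℕ) .{{_ : NonZero d}} .{{_ : NonZero N}}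
             (t<M : t < suc k) (N*inv≡1 : N * inv % suc k ≡ 1 % suc k) where

  open Inverse {suc k} {N} {inv} N*inv≡1

  M m n r c : ℕ
  M = suc k
  m = M * d
  n = N * d
  r = n * p + t * d
  c = p + t * inv % M

  solution⇒inProgression : ∀ {x y} → n * x ≡ m * y + r → InProgression c M x
  solution⇒inProgression {y = y} eq = reduced⇒inProgression p t {y = y} (÷-common-factor d M N p t eq)

  inProgression⇒solution : ∀ {x} → InProgression c M x → ∃[ y ] n * x ≡ m * y + r
  inProgression⇒solution prog with inProgression⇒reduced M N p t (N*[t*inv%M]%M≡t t<M) prog
  ... | y , eq = y , ×-common-factor d M N p t eq

  instance
    m≢0 : NonZero m
    m≢0 = m*n≢0 M d

  numSolutions≡ : numSolutions m n r ≡ length (filter (inProgression? c M) (upTo (suc m)))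
  numSolutions≡ =
    length-filter-cartesianProduct (λ (x , y) → T? (n * x ≡ᵇ m * y + r)) (inProgression? c M)
      (upTo (suc m)) (upTo (suc n)) one-solution no-solution
    where
    solution? : ∀ x → Decidable (λ y → T (n * x ≡ᵇ m * y + r))
    solution? x y = T? (n * x ≡ᵇ m * y + r)
    one-solution : ∀ {x} → x ∈ upTo (suc m) → InProgression c M x →
      length (filter (solution? x) (upTo (suc n))) ≡ 1
    one-solution {x} x∈ prog =
      let y₀ , eq₀ = inProgression⇒solution prog in
      length-filter-upTo-unique (solution? x)
        (λ {y} sol → sym (solution-unique {m} {n} {r} eq₀ (≡ᵇ⇒≡ (n * x) (m * y + r) sol)))
        (≡⇒≡ᵇ (n * x) (m * y₀ + r) eq₀)
        (s≤s (solution⇒y≤n {m} {n} {r} eq₀ (s≤s⁻¹ (∈-upTo⁻ x∈))))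
    no-solution : ∀ {x} → ¬ InProgression c M x → length (filter (solution? x) (upTo (suc n))) ≡ 0
    no-solution {x} ¬prog = cong length (filter-none (solution? x)
      (All.universal (λ y sol → ¬prog (solution⇒inProgression {y = y} (≡ᵇ⇒≡ (n * x) (m * y + r) sol)))
                     (upTo (suc n))))

  numSolutions+ceilDiv≡ : p ≤ m → numSolutions m n r + ceilDiv c M ≡ d + 1
  numSolutions+ceilDiv≡ p≤m = begin
    numSolutions m n r + ceilDiv c M
      ≡⟨ cong (_+ ceilDiv c M) (trans numSolutions≡ (length-filter-inProgression c k (suc m))) ⟩
    ceilDiv (suc m ∸ c) M + ceilDiv c M   ≡⟨ cong (_+ ceilDiv c M) (ceilDiv-∸ (suc m) c k) ⟩
    (suc m + k ∸ c) / M + ceilDiv c M     ≡⟨ cong (λ v → (v ∸ c) / M + ceilDiv c M) 1+m+k≡[d+1]*M ⟩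
    ((d + 1) * M ∸ c) / M + ceilDiv c M   ≡⟨ [m*n∸o]/n+ceilDiv[o,n]≡m (d + 1) k c≤[d+1]*M ⟩
    d + 1                                 ∎
    where
    1+m+k≡[d+1]*M : suc (suc k * d) + k ≡ (d + 1) * suc k
    1+m+k≡[d+1]*M = solve (k ∷ d ∷ [])
    c≤[d+1]*M : c ≤ (d + 1) * M
    c≤[d+1]*M = ≤-trans (+-mono-≤ p≤m (s≤s⁻¹ (m%n<n (t * inv) M)))
                        (≤-trans (n≤1+n _) (≤-reflexive 1+m+k≡[d+1]*M))

-- M is left general (rather than suc k) so that it can be instantiated by m / d below;
-- matching it against suc k then lets modℕ and ceilDiv compute.
numSolutions+ceilDiv≡′ : ∀ {m n r d M N p t} inv
  .{{_ : NonZero m}} .{{_ : NonZero n}} .{{_ : NonZero d}} →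
  m ≡ M * d → n ≡ N * d → r ≡ n * p + t * d → t < M → p ≤ m → modℕ (N * inv) M ≡ modℕ 1 M →
  numSolutions m n r + ceilDiv (p + modℕ (t * inv) M) M ≡ d + 1
numSolutions+ceilDiv≡′ {M = zero} _ refl _ _ _ _ _ = ⊥-elim (≢-nonZero⁻¹ 0 refl)
numSolutions+ceilDiv≡′ {M = suc _} {N = zero} _ _ refl _ _ _ _ = ⊥-elim (≢-nonZero⁻¹ 0 refl)
numSolutions+ceilDiv≡′ {d = d} {suc k} {suc N′} {p} {t} inv refl refl refl t<M p≤m N*inv≡1 =
  Count.numSolutions+ceilDiv≡ k d (suc N′) p t inv t<M N*inv≡1 p≤m

numSolutions+ceilDiv≡ : ∀ m n r d inv .{{_ : NonZero m}} .{{_ : NonZero n}} .{{_ : NonZero d}} →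
  d ∣ m → d ∣ n → d ∣ r → n ≤ m → r ≤ n * m →
  modℕ (divℕ n d * inv) (divℕ m d) ≡ modℕ 1 (divℕ m d) →
  numSolutions m n r + ceilDiv (pOf n r + modℕ (divℕ (r ∸ n * pOf n r) d * inv) (divℕ m d)) (divℕ m d)
    ≡ d + 1
numSolutions+ceilDiv≡ m n@(suc _) r d@(suc _) inv d∣m d∣n d∣r n≤m r≤n*m =
  numSolutions+ceilDiv≡′ {M = m / d} {N = n / d} inv
    (sym (m/n*n≡m d∣m)) (sym (m/n*n≡m d∣n)) r≡n*p+t*d t<M p≤m
  where
  p = r / n
  t = (r ∸ n * p) / d
  r%n≡r∸n*p : r % n ≡ r ∸ n * p
  r%n≡r∸n*p = trans (m%n≡m∸m/n*n r n) (cong (r ∸_) (*-comm p n))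
  t*d≡r%n : t * d ≡ r % n
  t*d≡r%n = trans (m/n*n≡m (subst (d ∣_) r%n≡r∸n*p (%-presˡ-∣ d∣r d∣n))) (sym r%n≡r∸n*p)
  r≡n*p+t*d : r ≡ n * p + t * d
  r≡n*p+t*d = begin
    r              ≡⟨ m≡m%n+[m/n]*n r n ⟩
    r % n + p * n  ≡⟨ +-comm (r % n) _ ⟩
    p * n + r % n  ≡⟨ cong₂ _+_ (*-comm p n) (sym t*d≡r%n) ⟩
    n * p + t * d  ∎
  t<M : t < m / d
  t<M = *-cancelʳ-< d t (m / d) (subst (_< m / d * d) (sym t*d≡r%n)
    (<-≤-trans (m%n<n r n) (≤-trans n≤m (≤-reflexive (sym (m/n*n≡m d∣m))))))
  p≤m : p ≤ m
  p≤m = ≤-trans (/-monoˡ-≤ n (≤-trans r≤n*m (≤-reflexive (*-comm n m)))) (≤-reflexive (m*n/n≡m m n))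

ℤ-solution⇒solution : ∀ {m n r a b} → + n ℤ.* + a - + m ℤ.* + b ≡ + r → n * a ≡ m * b + r
ℤ-solution⇒solution {m} {n} {r} {a} {b} eq = ℤₚ.+-injective (begin
  + (n * a)                                    ≡⟨ ℤₚ.pos-* n a ⟩
  + n ℤ.* + a                                  ≡⟨ //-rightDividesˡ (+ m ℤ.* + b) _ ⟨
  (+ n ℤ.* + a - + m ℤ.* + b) ℤ.+ + m ℤ.* + b   ≡⟨ cong (ℤ._+ (+ m ℤ.* + b)) eq ⟩
  + r ℤ.+ + m ℤ.* + b                          ≡⟨ cong (ℤ._+_ (+ r)) (ℤₚ.pos-* m b) ⟨
  + r ℤ.+ + (m * b)                            ≡⟨ ℤₚ.pos-+ r (m * b) ⟨
  + (r + m * b)                                ≡⟨ cong +_ (+-comm r _) ⟩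
  + (m * b + r)                                ∎)

m+n≡o⇒+m≡+o-+n : ∀ {a b c} → a + b ≡ c → + a ≡ + c - + b
m+n≡o⇒+m≡+o-+n {a} {b} refl =
  sym (trans (cong (_- + b) (ℤₚ.pos-+ a b)) (//-rightDividesʳ (+ b) (+ a)))

lemma2 : (m n r : ℕ) → NonZero m → NonZero n → m ≥ n →
    ((Σ ℤ λ x → Σ ℤ λ y →
        (+ 0 Data.Integer.≤ x) × (x Data.Integer.≤ + m) ×
        (+ 0 Data.Integer.≤ y) × (y Data.Integer.≤ + n) ×
        ((+ n Data.Integer.* x) - (+ m Data.Integer.* y) ≡ + r)) →
      (gcd m n ∣ r) × (r ≤ n Data.Nat.* m))
    ×
    (gcd m n ∣ r → r ≤ n Data.Nat.* m →
      (inv : ℕ) → inv < divℕ m (gcd m n) →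
      modℕ (divℕ n (gcd m n) Data.Nat.* inv) (divℕ m (gcd m n)) ≡ modℕ 1 (divℕ m (gcd m n)) →
      + numSolutions m n r ≡ alpha m n r inv)
lemma2 m n r m≢0 n≢0 n≤m =
  (λ { (+ x , + y , _ , +≤+ x≤m , _ , _ , eq) →
         let n*x≡m*y+r = ℤ-solution⇒solution {m} {n} {r} {x} {y} eq in
         solution⇒∣ {m} {n} {r} n*x≡m*y+r (gcd[m,n]∣m m n) (gcd[m,n]∣n m n) ,
         solution⇒≤ {m} {n} {r} n*x≡m*y+r x≤m }) ,
  λ gcd∣r r≤n*m inv _ N*inv≡1 → m+n≡o⇒+m≡+o-+n
    (numSolutions+ceilDiv≡ m n r (gcd m n) inv {{m≢0}} {{n≢0}} {{gcd≢0}}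
      (gcd[m,n]∣m m n) (gcd[m,n]∣n m n) gcd∣r n≤m r≤n*m N*inv≡1)
  where
  gcd≢0 : NonZero (gcd m n)
  gcd≢0 = ≢-nonZero (gcd[m,n]≢0 m n (inj₁ (≢-nonZero⁻¹ m {{m≢0}})))
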